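{- Let $d\ge1$, let $n_1,\dots,n_d$ be positive integers, $N_j = 2^{n_j}$, $N = N_1\cdots N_d$, and let $m\ge1$. Let $H_{n_j} \in \mathbb{R}^{N_j\times N_j}$ be the normalized Hadamard matrix with entries $(H_{n_j})_{ab} = N_j^{ -1/2}(-1)^{\langle a-1, b-1\rangle_b}$, and $F = H_{n_1}\otimes\dots\otimes H_{n_d}$. Let $P_\Omega \in \mathbb{R}^{m\times N}$ be the random matrix whose $i$-th row is $\sqrt{N/m}\, e_{\omega_i}^T$ with $\omega_1,\dots,\omega_m$ i.i.d. uniform on $[N]$. Let $2 \le r \le \min\{n_1,\dots,n_d\}$, $s = 2^r$, and for each $j$ let $V_j$ be an $r$-dimensional subspace of $\mathbb{F}_2^{n_j}$. Let \[ E := \{ (D_{\hat\xi^{(1)}}\mathbb{1}_{V_1})\otimes\dots\otimes(D_{\hat\xi^{(d)}}\mathbb{1}_{V_d}) : \hat\xi^{(j)} \in \{\pm1\}^{N_j} \}, \] a set of unit vectors with $p := |E| \le 2^{ds}$. Then with probability at least $\exp(-2m/s^d)$ with respect to $P_\Omega$, the following holds: for every $\xi = \xi^{(1)}\otimes\dots\otimes\xi^{(d)}$ with $\xi^{(j)}\in\{\pm1\}^{N_j}$ there exists $\hat x \in E$ with $P_\Omega F D_\xi \hat x = 0$; in particular $\sup_{x\in E} |\|P_\Omega F D_\xi x\|_2 - 1| \ge 1$.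
   Context: $\langle a,b\rangle_b$ denotes the $\mathbb{F}_2$ inner product of the binary representations of $a$ and $b$; coordinates of $\mathbb{R}^{N_j}$ are identified with elements of $\mathbb{F}_2^{n_j}$ via binary representation of (index $-1$). For $M\subset\mathbb{F}_2^{n}$, $\mathbb{1}_M\in\mathbb{R}^{2^n}$ is the indicator vector of $M$ normalized to have Euclidean norm $1$. $D_v$ is the diagonal matrix with diagonal $v$. -}

module Defs where

open import Data.Bool using (Bool; true; false; if_then_else_; _xor_; _∧_)
open import Data.Nat using (ℕ; zero; suc; _+_; _*_; _^_; _≤_; _!)

open import Data.Integer as ℤ using (ℤ)
open import Data.Fin using (Fin; zero; suc)
open import Data.Vec using (Vec; []; _∷_; replicate; zipWith)
open import Data.Product using (Σ; _×_; _,_)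
open import Data.List using (List; length)
open import Data.List.Relation.Unary.All using (All)
open import Data.List.Relation.Unary.Unique.Propositional using (Unique)
open import Relation.Binary.PropositionalEquality using (_≡_)

-- F₂^n is represented as Vec Bool n (true = 1).
F2 : ℕ → Set
F2 n = Vec Bool n

ip : ∀ {n} → F2 n → F2 n → Bool
ip [] [] = false
ip (a ∷ as) (b ∷ bs) = (a ∧ b) xor ip as bs

_⊕_ : ∀ {n} → F2 n → F2 n → F2 n
_⊕_ = zipWith _xor_

sgn : Bool → ℤ
sgn false = ℤ.+ 1
sgn true  = ℤ.-[1+ 0 ]

ind : Bool → ℤ
ind true = ℤ.+ 1
ind false = ℤ.+ 0

indℕ : Bool → ℕ
indℕ true = 1
indℕ false = 0

sumF2 : ∀ {A : Set} → (A → A → A) → (n : ℕ) → (F2 n → A) → A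
sumF2 _+'_ zero f = f []
sumF2 _+'_ (suc n) f = sumF2 _+'_ n (λ v → f (false ∷ v)) +' sumF2 _+'_ n (λ v → f (true ∷ v))

-- multi-indices: elements of F₂^{n₁} × ... × F₂^{n_d}, which index the
-- coordinates of ℝ^{N₁} ⊗ ... ⊗ ℝ^{N_d} = ℝ^N
Idx : ∀ {d} → (Fin d → ℕ) → Set
Idx {d} n = (j : Fin d) → F2 (n j)

consIdx : ∀ {d} {n : Fin (suc d) → ℕ} → F2 (n zero) → Idx (λ j → n (suc j)) → Idx n
consIdx v t zero = v
consIdx v t (suc j) = t j

sumIdx : ∀ {d} (n : Fin d → ℕ) → (Idx n → ℤ) → ℤ
sumIdx {zero} n f = f (λ ())
sumIdx {suc d} n f = sumF2 ℤ._+_ (n zero) (λ v → sumIdx (λ j → n (suc j)) (λ t → f (consIdx v t)))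

prodFin : ∀ d → (Fin d → ℤ) → ℤ
prodFin zero g = ℤ.+ 1
prodFin (suc d) g = g zero ℤ.* prodFin d (λ j → g (suc j))

prodFinℕ : ∀ d → (Fin d → ℕ) → ℕ
prodFinℕ zero g = 1
prodFinℕ (suc d) g = g zero * prodFinℕ d (λ j → g (suc j))

record IsSubspace (n r : ℕ) (V : F2 n → Bool) : Set where
  field
    zero-mem : V (replicate n false) ≡ true
    add-mem  : ∀ u v → V u ≡ true → V v ≡ true → V (u ⊕ v) ≡ true
    card     : sumF2 _+_ n (λ v → indℕ (V v)) ≡ 2 ^ r

-- Unnormalised entries of F = H_{n₁} ⊗ ... ⊗ H_{n_d} (the N^{-1/2} factor dropped):
-- F(a,b) = ∏_j (-1)^{⟨a_j,b_j⟩}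
Fent : ∀ {d} (n : Fin d → ℕ) → Idx n → Idx n → ℤ
Fent {d} n a b = prodFin d (λ j → sgn (ip (a j) (b j)))

-- Sign pattern ξ = ξ^(1) ⊗ ... ⊗ ξ^(d), ξ^(j) ∈ {±1}^{N_j}, encoded by Bool (true = -1)
Signs : ∀ {d} → (Fin d → ℕ) → Set
Signs {d} n = (j : Fin d) → F2 (n j) → Bool

tensorSign : ∀ {d} (n : Fin d → ℕ) → Signs n → Idx n → ℤ
tensorSign {d} n ξ b = prodFin d (λ j → sgn (ξ j (b j)))

-- Element of E with signs ξ̂, up to the positive factor 2^{-dr/2}:
-- x̂(b) = ∏_j ξ̂^(j)(b_j) · 1[b_j ∈ V_j]
Evec : ∀ {d} (n : Fin d → ℕ) → ((j : Fin d) → F2 (n j) → Bool) → Signs n → Idx n → ℤ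
Evec {d} n V ξ̂ b = prodFin d (λ j → sgn (ξ̂ j (b j)) ℤ.* ind (V j (b j)))

Sample : ∀ {d} → (Fin d → ℕ) → ℕ → Set
Sample n m = Fin m → Idx n

-- (P_Ω F D_ξ x̂) = 0: each row is √(N/m) · Σ_b F(ω_i,b) ξ(b) x̂(b), so it vanishes iff the sum does.
KillsAll : ∀ {d} (n : Fin d → ℕ) (m : ℕ) (V : (j : Fin d) → F2 (n j) → Bool) → Sample n m → Set
KillsAll n m V ω =
  (ξ : Signs n) → Σ (Signs n) λ ξ̂ → (i : Fin m) →
    sumIdx n (λ b → Fent n (ω i) b ℤ.* tensorSign n ξ b ℤ.* Evec n V ξ̂ b) ≡ ℤ.+ 0

-- expPartial x K = K! · Σ_{k=0}^{K} x^k / k!   (a natural number)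
expPartial : ℕ → ℕ → ℕ
expPartial x zero = 1
expPartial x (suc K) = suc K * expPartial x K + x ^ suc K

-- For naturals a, b (b > 0) and S > 0:  a/b ≤ exp(-c/S)  ⟺  (a/b)^S · e^c ≤ 1
--   ⟺ ∀ K, a^S · (Σ_{k≤K} c^k/k!) ≤ b^S.
LeExpNeg : (a b c S : ℕ) → Set
LeExpNeg a b c S = ∀ K → a ^ S * expPartial c K ≤ b ^ S * (K !)

-- "Pr_ω[P ω] ≥ a/b" for ω uniform on Sample n m (|Sample| = N^m):
-- there are at least (a/b)·N^m distinct samples satisfying P.
ProbAtLeast : ∀ {d} (n : Fin d → ℕ) (m : ℕ) → (Sample n m → Set) → ℕ → ℕ → Set
ProbAtLeast {d} n m P a b =
  Σ (List (Sample n m)) λ l → Unique l × All P l × (a * (prodFinℕ d (λ j → 2 ^ n j)) ^ m ≤ b * length l)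

{-# OPTIONS --safe #-}
-- For a sample index t, the row of P_Ω F D_ξ applied to the vector of E whose signs are ξ̂ = ξ
-- factorises as ∏_j Σ_{x ∈ V_j} (-1)^⟨t_j,x⟩, and each factor is 2^r if t_j ∈ V_j^⊥ and 0 otherwise
-- (translating by some x ∈ V_j with ⟨t_j,x⟩ = 1 negates the sum).  So this one vector is annihilated
-- by every row except those indexed by V_1^⊥ × … × V_d^⊥, whose size N / s^d follows from Fourier
-- inversion at 0.  All m samples avoid that set with probability (1 - s^-d)^m, which is at least
-- exp(-2m/s^d) because (1 + x/K)^K ≤ Σ_{k ≤ K} x^k / k!.
module Submission where

open import Defs

module TruncatedExponential where
  open import Data.Nat
  open import Data.Nat.Properties
  open import Data.Nat.Tactic.RingSolver using (solve-∀)
  open import Relation.Binary.PropositionalEquality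

  sumBelow : ℕ → (ℕ → ℕ) → ℕ
  sumBelow zero    f = 0
  sumBelow (suc L) f = sumBelow L f + f L

  sumBelow-cong : ∀ L {f g : ℕ → ℕ} → (∀ k → f k ≡ g k) → sumBelow L f ≡ sumBelow L g
  sumBelow-cong zero    f≗g = refl
  sumBelow-cong (suc L) f≗g = cong₂ _+_ (sumBelow-cong L f≗g) (f≗g L)

  sumBelow-suc : ∀ L f → sumBelow (suc L) f ≡ f 0 + sumBelow L (λ k → f (suc k))
  sumBelow-suc zero    f = +-comm 0 (f 0)
  sumBelow-suc (suc L) f = begin
    sumBelow (suc L) f + f (suc L)                ≡⟨ cong (_+ f (suc L)) (sumBelow-suc L f) ⟩
    f 0 + sumBelow L (λ k → f (suc k)) + f (suc L) ≡⟨ +-assoc (f 0) _ _ ⟩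
    f 0 + sumBelow (suc L) (λ k → f (suc k))       ∎
    where open ≡-Reasoning

  sumBelow-+ : ∀ L f g → sumBelow L (λ k → f k + g k) ≡ sumBelow L f + sumBelow L g
  sumBelow-+ zero    f g = refl
  sumBelow-+ (suc L) f g = begin
    sumBelow L (λ k → f k + g k) + (f L + g L)     ≡⟨ cong (_+ (f L + g L)) (sumBelow-+ L f g) ⟩
    sumBelow L f + sumBelow L g + (f L + g L)      ≡⟨ +-+-interchange (sumBelow L f) _ _ _ ⟩
    sumBelow L f + f L + (sumBelow L g + g L)      ∎
    where
    open ≡-Reasoning
    +-+-interchange : ∀ a b c d → a + b + (c + d) ≡ a + c + (b + d)
    +-+-interchange = solve-∀

  sumBelow-*ˡ : ∀ L c f → sumBelow L (λ k → c * f k) ≡ c * sumBelow L f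
  sumBelow-*ˡ zero    c f = sym (*-zeroʳ c)
  sumBelow-*ˡ (suc L) c f =
    trans (cong (_+ c * f L) (sumBelow-*ˡ L c f)) (sym (*-distribˡ-+ c (sumBelow L f) (f L)))

  -- The coefficient of x^k in (K + x)^n, namely C(n,k) K^(n-k).
  powCoeff : ℕ → ℕ → ℕ → ℕ
  powCoeff K zero    zero    = 1
  powCoeff K zero    (suc k) = 0
  powCoeff K (suc n) zero    = K * powCoeff K n zero
  powCoeff K (suc n) (suc k) = K * powCoeff K n (suc k) + powCoeff K n k

  powCoeff-vanishes : ∀ K {n k} → n < k → powCoeff K n k ≡ 0
  powCoeff-vanishes K {zero}  {suc k} _ = refl
  powCoeff-vanishes K {suc n} {suc k} (s≤s n<k)
    rewrite powCoeff-vanishes K (m<n⇒m<1+n n<k) | powCoeff-vanishes K n<k | *-zeroʳ K = refl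

  binomial-expansion : ∀ K x n → (K + x) ^ n ≡ sumBelow (suc n) (λ k → powCoeff K n k * x ^ k)
  binomial-expansion K x zero    = refl
  binomial-expansion K x (suc n) = begin
    (K + x) * (K + x) ^ n
      ≡⟨ cong ((K + x) *_) (binomial-expansion K x n) ⟩
    (K + x) * P
      ≡⟨ *-distribʳ-+ P K x ⟩
    K * P + x * P
      ≡⟨ cong (λ s → K * s + x * P) (+-identityʳ P) ⟨
    K * (P + 0) + x * P
      ≡⟨ cong (λ z → K * (P + z * x ^ suc n) + x * P) (powCoeff-vanishes K (n<1+n n)) ⟨
    K * sumBelow (suc (suc n)) (c n) + x * P
      ≡⟨ cong (λ s → K * s + x * P) (sumBelow-suc (suc n) (c n)) ⟩
    K * (b n 0 * 1 + T) + x * P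
      ≡⟨ regroup K x (b n 0) T P ⟩
    c (suc n) 0 + (K * T + x * P)
      ≡⟨ cong₂ (λ u v → c (suc n) 0 + (u + v)) (sumBelow-*ˡ (suc n) K _) (sumBelow-*ˡ (suc n) x _) ⟨
    c (suc n) 0 + (sumBelow (suc n) (λ k → K * (b n (suc k) * x ^ suc k))
                 + sumBelow (suc n) (λ k → x * (b n k * x ^ k)))
      ≡⟨ cong (c (suc n) 0 +_) (sumBelow-+ (suc n) _ _) ⟨
    c (suc n) 0 + sumBelow (suc n) (λ k → K * (b n (suc k) * x ^ suc k) + x * (b n k * x ^ k))
      ≡⟨ cong (c (suc n) 0 +_) (sumBelow-cong (suc n) λ k → pascal K x (b n (suc k)) (b n k) (x ^ k)) ⟩
    c (suc n) 0 + sumBelow (suc n) (λ k → c (suc n) (suc k))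
      ≡⟨ sumBelow-suc (suc n) (c (suc n)) ⟨
    sumBelow (suc (suc n)) (c (suc n)) ∎
    where
    open ≡-Reasoning
    b = powCoeff K
    c : ℕ → ℕ → ℕ
    c n k = b n k * x ^ k
    P = sumBelow (suc n) (c n)
    T = sumBelow (suc n) (λ k → c n (suc k))
    regroup : ∀ K x b₀ t p → K * (b₀ * 1 + t) + x * p ≡ K * b₀ * 1 + (K * t + x * p)
    regroup = solve-∀
    pascal : ∀ K x u v y → K * (u * (x * y)) + x * (v * y) ≡ (K * u + v) * (x * y)
    pascal = solve-∀

  binomial-leading-terms : ∀ n k → n ^ suc k + suc k * n ^ k ≤ suc n ^ suc k
  binomial-leading-terms n zero    = ≤-reflexive (base n)
    where
    base : ∀ n → n * 1 + 1 * 1 ≡ (1 + n) * 1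
    base = solve-∀
  binomial-leading-terms n (suc k) = begin
    n ^ suc (suc k) + suc (suc k) * n ^ suc k
      ≡⟨ expand n k (n ^ k) ⟩
    n * n ^ suc k + 1 * n ^ suc k + n * (suc k * n ^ k)
      ≤⟨ m≤m+n _ (suc k * n ^ k) ⟩
    n * n ^ suc k + 1 * n ^ suc k + n * (suc k * n ^ k) + suc k * n ^ k
      ≡⟨ factor n (n ^ suc k) (suc k * n ^ k) ⟩
    suc n * (n ^ suc k + suc k * n ^ k)
      ≤⟨ *-monoʳ-≤ (suc n) (binomial-leading-terms n k) ⟩
    suc n ^ suc (suc k) ∎
    where
    open ≤-Reasoning
    expand : ∀ n k y → n * (n * y) + (2 + k) * (n * y) ≡ n * (n * y) + 1 * (n * y) + n * ((1 + k) * y)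
    expand = solve-∀
    factor : ∀ n a b → n * a + 1 * a + n * b + b ≡ (1 + n) * (a + b)
    factor = solve-∀

  powCoeff-bound : ∀ K n k → powCoeff K n k * k ! * K ^ k ≤ n ^ k * K ^ n
  powCoeff-bound K zero    zero    = ≤-refl
  powCoeff-bound K zero    (suc k) = z≤n
  powCoeff-bound K (suc n) zero    = begin
    K * b n 0 * 1 * 1   ≡⟨ shuffle₁ K (b n 0) ⟩
    K * (b n 0 * 1 * 1) ≤⟨ *-monoʳ-≤ K (powCoeff-bound K n 0) ⟩
    K * (1 * K ^ n)     ≡⟨ shuffle₂ K (K ^ n) ⟩
    1 * (K * K ^ n)     ∎
    where
    open ≤-Reasoning
    b = powCoeff K
    shuffle₁ : ∀ K b → K * b * 1 * 1 ≡ K * (b * 1 * 1)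
    shuffle₁ = solve-∀
    shuffle₂ : ∀ K q → K * (1 * q) ≡ 1 * (K * q)
    shuffle₂ = solve-∀
  powCoeff-bound K (suc n) (suc k) = begin
    (K * b n (suc k) + b n k) * (suc k * k !) * (K * K ^ k)
      ≡⟨ split K (b n (suc k)) (b n k) k (k !) (K ^ k) ⟩
    K * (b n (suc k) * (suc k * k !) * (K * K ^ k)) + suc k * K * (b n k * k ! * K ^ k)
      ≤⟨ +-mono-≤ (*-monoʳ-≤ K (powCoeff-bound K n (suc k)))
                  (*-monoʳ-≤ (suc k * K) (powCoeff-bound K n k)) ⟩
    K * (n ^ suc k * K ^ n) + suc k * K * (n ^ k * K ^ n)
      ≡⟨ factor K (n ^ suc k) (K ^ n) (suc k) (n ^ k) ⟩
    K * K ^ n * (n ^ suc k + suc k * n ^ k)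
      ≤⟨ *-monoʳ-≤ (K * K ^ n) (binomial-leading-terms n k) ⟩
    K * K ^ n * suc n ^ suc k
      ≡⟨ *-comm (K * K ^ n) _ ⟩
    suc n ^ suc k * (K * K ^ n) ∎
    where
    open ≤-Reasoning
    b = powCoeff K
    split : ∀ K b₁ b₀ k f p → (K * b₁ + b₀) * ((1 + k) * f) * (K * p)
                              ≡ K * (b₁ * ((1 + k) * f) * (K * p)) + (1 + k) * K * (b₀ * f * p)
    split = solve-∀
    factor : ∀ K a q c d → K * (a * q) + c * K * (d * q) ≡ K * q * (a + c * d)
    factor = solve-∀

  expPartial-dominates : ∀ x n (c : ℕ → ℕ) M → (∀ k → k ≤ n → c k * k ! ≤ M) →
                         n ! * sumBelow (suc n) (λ k → c k * x ^ k) ≤ M * expPartial x n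
  expPartial-dominates x zero    c M c≤M = begin
    1 * (0 + c 0 * 1) ≡⟨ simplify (c 0) ⟩
    c 0 * 1           ≤⟨ c≤M 0 z≤n ⟩
    M                 ≡⟨ *-identityʳ M ⟨
    M * 1             ∎
    where
    open ≤-Reasoning
    simplify : ∀ a → 1 * (0 + a * 1) ≡ a * 1
    simplify = solve-∀
  expPartial-dominates x (suc n) c M c≤M = begin
    suc n * n ! * (S + c (suc n) * x ^ suc n)
      ≡⟨ split (suc n) (n !) S (c (suc n)) (x ^ suc n) ⟩
    suc n * (n ! * S) + c (suc n) * (suc n * n !) * x ^ suc n
      ≤⟨ +-mono-≤ (*-monoʳ-≤ (suc n) (expPartial-dominates x n c M λ k k≤n → c≤M k (m≤n⇒m≤1+n k≤n)))
                  (*-monoˡ-≤ (x ^ suc n) (c≤M (suc n) ≤-refl)) ⟩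
    suc n * (M * expPartial x n) + M * x ^ suc n
      ≡⟨ factor (suc n) M (expPartial x n) (x ^ suc n) ⟩
    M * (suc n * expPartial x n + x ^ suc n) ∎
    where
    open ≤-Reasoning
    S = sumBelow (suc n) (λ k → c k * x ^ k)
    split : ∀ a f s c p → a * f * (s + c * p) ≡ a * (f * s) + c * (a * f) * p
    split = solve-∀
    factor : ∀ a M e p → a * (M * e) + M * p ≡ M * (a * e + p)
    factor = solve-∀

  -- (1 + x/K)^K ≤ Σ_{k ≤ K} x^k / k!, multiplied by K^K K!.
  compound≤expPartial : ∀ K x .{{_ : NonZero K}} → K ! * (K + x) ^ K ≤ K ^ K * expPartial x K
  compound≤expPartial K x = begin
    K ! * (K + x) ^ K
      ≡⟨ cong (K ! *_) (binomial-expansion K x K) ⟩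
    K ! * sumBelow (suc K) (λ k → powCoeff K K k * x ^ k)
      ≤⟨ expPartial-dominates x K (powCoeff K K) (K ^ K) coeff≤ ⟩
    K ^ K * expPartial x K ∎
    where
    open ≤-Reasoning
    coeff≤ : ∀ k → k ≤ K → powCoeff K K k * k ! ≤ K ^ K
    coeff≤ k _ = *-cancelʳ-≤ _ _ (K ^ k) {{m^n≢0 K k}}
      (≤-trans (powCoeff-bound K K k) (≤-reflexive (*-comm (K ^ k) (K ^ K))))

  ^-distribʳ-* : ∀ x y n → (x * y) ^ n ≡ x ^ n * y ^ n
  ^-distribʳ-* x y zero    = refl
  ^-distribʳ-* x y (suc n) =
    trans (cong ((x * y) *_) (^-distribʳ-* x y n)) (interchange x y (x ^ n) (y ^ n))
    where
    interchange : ∀ a b c d → a * b * (c * d) ≡ a * c * (b * d)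
    interchange = solve-∀

  ^-cancelʳ-≤ : ∀ n .{{_ : NonZero n}} {x y} → x ^ n ≤ y ^ n → x ≤ y
  ^-cancelʳ-≤ n xⁿ≤yⁿ = ≮⇒≥ λ y<x → <⇒≱ (^-monoˡ-< n y<x) xⁿ≤yⁿ

  compound-ratio : ∀ m q .{{_ : NonZero m}} .{{_ : NonZero q}} →
    (2 * m * q) ! * suc q ^ (2 * m * q) ≤ q ^ (2 * m * q) * expPartial (2 * m) (2 * m * q)
  compound-ratio m q = *-cancelˡ-≤ (x ^ K) (begin
    x ^ K * (K ! * suc q ^ K)   ≡⟨ swap (x ^ K) (K !) (suc q ^ K) ⟩
    K ! * (x ^ K * suc q ^ K)   ≡⟨ cong (K ! *_) (^-distribʳ-* x (suc q) K) ⟨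
    K ! * (x * suc q) ^ K       ≡⟨ cong (λ z → K ! * z ^ K) (*-suc x q) ⟩
    K ! * (x + K) ^ K           ≡⟨ cong (λ z → K ! * z ^ K) (+-comm x K) ⟩
    K ! * (K + x) ^ K           ≤⟨ compound≤expPartial K x ⟩
    K ^ K * E                   ≡⟨ cong (_* E) (^-distribʳ-* x q K) ⟩
    x ^ K * q ^ K * E           ≡⟨ *-assoc (x ^ K) (q ^ K) E ⟩
    x ^ K * (q ^ K * E)         ∎)
    where
    open ≤-Reasoning
    x = 2 * m
    K = x * q
    E = expPartial x K
    instance
      x≢0 : NonZero x
      x≢0 = m*n≢0 2 m
      K≢0 : NonZero K
      K≢0 = m*n≢0 x q
      xᴷ≢0 : NonZero (x ^ K)
      xᴷ≢0 = m^n≢0 x K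
    swap : ∀ p q r → p * (q * r) ≡ q * (p * r)
    swap = solve-∀

  ^-ratio-shorten : ∀ {A C x y L} .{{_ : NonZero x}} → x ≤ y → ∀ e →
                    A * y ^ (L + e) ≤ x ^ (L + e) * C → A * y ^ L ≤ x ^ L * C
  ^-ratio-shorten {A} {C} {x} {y} {L} x≤y e long = *-cancelˡ-≤ (x ^ e) {{m^n≢0 x e}} (begin
    x ^ e * (A * y ^ L)     ≤⟨ *-monoˡ-≤ (A * y ^ L) (^-monoˡ-≤ e x≤y) ⟩
    y ^ e * (A * y ^ L)     ≡⟨ rearrange (y ^ e) A (y ^ L) ⟩
    A * (y ^ L * y ^ e)     ≡⟨ cong (A *_) (^-distribˡ-+-* y L e) ⟨
    A * y ^ (L + e)         ≤⟨ long ⟩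
    x ^ (L + e) * C         ≡⟨ cong (_* C) (^-distribˡ-+-* x L e) ⟩
    x ^ L * x ^ e * C       ≡⟨ rearrange′ (x ^ L) (x ^ e) C ⟩
    x ^ e * (x ^ L * C)     ∎)
    where
    open ≤-Reasoning
    rearrange : ∀ p a q → p * (a * q) ≡ a * (q * p)
    rearrange = solve-∀
    rearrange′ : ∀ p q c → p * q * c ≡ q * (p * c)
    rearrange′ = solve-∀

  -- With K = 2m(S-1): (S/(S-1))^(mS) ≤ (S/(S-1))^K ≤ e^(2m) ≤ (b/a)^S.
  leExpNeg⇒ : ∀ {a b} S m → 2 ≤ S → 1 ≤ m → LeExpNeg a b (2 * m) S → a * S ^ m ≤ b * (S ∸ 1) ^ m
  leExpNeg⇒ {a} {b} S@(suc q@(suc u)) m@(suc _) (s≤s (s≤s z≤n)) (s≤s z≤n) hyp =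
    ^-cancelʳ-≤ S (*-cancelʳ-≤ _ _ (K !) {{K !≢0}} (begin
      (a * S ^ m) ^ S * K !         ≡⟨ cong (_* K !) (^-distribʳ-* a (S ^ m) S) ⟩
      a ^ S * (S ^ m) ^ S * K !     ≡⟨ cong (λ z → a ^ S * z * K !) (^-*-assoc S m S) ⟩
      a ^ S * S ^ (m * S) * K !     ≡⟨ rotate (a ^ S) (S ^ (m * S)) (K !) ⟩
      a ^ S * (K ! * S ^ (m * S))   ≤⟨ *-monoʳ-≤ (a ^ S) ratio ⟩
      a ^ S * (q ^ (m * S) * E)     ≡⟨ swap (a ^ S) (q ^ (m * S)) E ⟩
      q ^ (m * S) * (a ^ S * E)     ≤⟨ *-monoʳ-≤ (q ^ (m * S)) (hyp K) ⟩
      q ^ (m * S) * (b ^ S * K !)   ≡⟨ swap (q ^ (m * S)) (b ^ S) (K !) ⟩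
      b ^ S * (q ^ (m * S) * K !)   ≡⟨ *-assoc (b ^ S) (q ^ (m * S)) (K !) ⟨
      b ^ S * q ^ (m * S) * K !     ≡⟨ cong (λ z → b ^ S * z * K !) (^-*-assoc q m S) ⟨
      b ^ S * (q ^ m) ^ S * K !     ≡⟨ cong (_* K !) (^-distribʳ-* b (q ^ m) S) ⟨
      (b * q ^ m) ^ S * K !         ∎))
    where
    open ≤-Reasoning
    K = 2 * m * q
    E = expPartial (2 * m) K
    rotate : ∀ p q r → p * q * r ≡ p * (r * q)
    rotate = solve-∀
    swap : ∀ p q r → p * (q * r) ≡ q * (p * r)
    swap = solve-∀
    K≡mS+mu : ∀ m u → 2 * m * (1 + u) ≡ m * (2 + u) + m * u
    K≡mS+mu = solve-∀
    ratio : K ! * S ^ (m * S) ≤ q ^ (m * S) * E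
    ratio = ^-ratio-shorten {K !} {E} {L = m * S} (n≤1+n q) (m * u)
              (subst (λ L → K ! * S ^ L ≤ q ^ L * E) (K≡mS+mu m u) (compound-ratio m q))

  good-fraction-bound : ∀ a b m {S B G} → 1 ≤ S → B * S ≤ G + B → a * S ^ m ≤ b * (S ∸ 1) ^ m →
                        a * (B * S) ^ m ≤ b * G ^ m
  good-fraction-bound a b m {suc q} {B} {G} (s≤s z≤n) few-bad fraction = begin
    a * (B * suc q) ^ m      ≡⟨ cong (a *_) (^-distribʳ-* B (suc q) m) ⟩
    a * (B ^ m * suc q ^ m)  ≡⟨ swap a (B ^ m) (suc q ^ m) ⟩
    B ^ m * (a * suc q ^ m)  ≤⟨ *-monoʳ-≤ (B ^ m) fraction ⟩
    B ^ m * (b * q ^ m)      ≡⟨ swap (B ^ m) b (q ^ m) ⟩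
    b * (B ^ m * q ^ m)      ≡⟨ cong (b *_) (^-distribʳ-* B q m) ⟨
    b * (B * q) ^ m          ≤⟨ *-monoʳ-≤ b (^-monoˡ-≤ m B*q≤G) ⟩
    b * G ^ m                ∎
    where
    open ≤-Reasoning
    swap : ∀ p q r → p * (q * r) ≡ q * (p * r)
    swap = solve-∀
    B*q≤G : B * q ≤ G
    B*q≤G = +-cancelʳ-≤ B (B * q) G (begin
      B * q + B  ≡⟨ +-comm (B * q) B ⟩
      B + B * q  ≡⟨ *-suc B q ⟨
      B * suc q  ≤⟨ few-bad ⟩
      G + B      ∎)

module HadamardTransform where
  open import Data.Bool using (Bool; true; false; not; _xor_; _∧_)
  open import Data.Bool.Properties
    using (∧-distribˡ-xor; xor-assoc; xor-comm; xor-same; xor-identityʳ; true-xor; xor-∧-commutativeRing)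
  open import Data.Nat using (ℕ; zero; suc; _^_)
  import Data.Nat as ℕ
  import Data.Nat.Properties as ℕ
  open import Data.Integer using (ℤ; +_; -_; _+_; _*_; 0ℤ; 1ℤ)
  open import Data.Integer.Properties
  open import Data.Product using (∃; _×_; _,_)
  open import Data.Sum using (_⊎_; inj₁; inj₂)
  open import Data.Vec using ([]; _∷_; replicate)
  open import Data.Fin using (Fin; zero; suc)
  open import Function using (_∘_)
  open import Relation.Binary.PropositionalEquality
  open import Algebra.Bundles using (CommutativeRing)
  import Algebra.Properties.CommutativeSemigroup as CommutativeSemigroupProperties

  module _ {A : Set} (_∙_ : A → A → A) where

    sumF2-cong : ∀ n {f g : F2 n → A} → (∀ x → f x ≡ g x) → sumF2 _∙_ n f ≡ sumF2 _∙_ n g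
    sumF2-cong zero    f≗g = f≗g []
    sumF2-cong (suc n) f≗g =
      cong₂ _∙_ (sumF2-cong n (f≗g ∘ (false ∷_))) (sumF2-cong n (f≗g ∘ (true ∷_)))

    sumF2-hom : ∀ {B : Set} {_◦_ : B → B → B} (φ : A → B) → (∀ a b → φ (a ∙ b) ≡ φ a ◦ φ b) →
                ∀ n (f : F2 n → A) → sumF2 _◦_ n (φ ∘ f) ≡ φ (sumF2 _∙_ n f)
    sumF2-hom φ φ-hom zero    f = refl
    sumF2-hom {_◦_ = _◦_} φ φ-hom (suc n) f = trans
      (cong₂ _◦_ (sumF2-hom φ φ-hom n (f ∘ (false ∷_))) (sumF2-hom φ φ-hom n (f ∘ (true ∷_))))
      (sym (φ-hom _ _))

  ∑ : (n : ℕ) → (F2 n → ℤ) → ℤ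
  ∑ = sumF2 _+_

  ∑-cong : ∀ n {f g : F2 n → ℤ} → (∀ x → f x ≡ g x) → ∑ n f ≡ ∑ n g
  ∑-cong = sumF2-cong _+_

  ∑-*ˡ : ∀ n c (f : F2 n → ℤ) → ∑ n (λ x → c * f x) ≡ c * ∑ n f
  ∑-*ˡ n c = sumF2-hom _+_ (c *_) (*-distribˡ-+ c) n

  ∑-*ʳ : ∀ n c (f : F2 n → ℤ) → ∑ n (λ x → f x * c) ≡ ∑ n f * c
  ∑-*ʳ n c = sumF2-hom _+_ (_* c) (λ a b → *-distribʳ-+ c a b) n

  ∑-neg : ∀ n (f : F2 n → ℤ) → ∑ n (λ x → - f x) ≡ - ∑ n f
  ∑-neg = sumF2-hom _+_ -_ neg-distrib-+

  ∑-pos : ∀ n (f : F2 n → ℕ) → ∑ n (λ x → + f x) ≡ + sumF2 ℕ._+_ n f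
  ∑-pos = sumF2-hom ℕ._+_ +_ pos-+

  ∑-+ : ∀ n (f g : F2 n → ℤ) → ∑ n (λ x → f x + g x) ≡ ∑ n f + ∑ n g
  ∑-+ zero    f g = refl
  ∑-+ (suc n) f g = trans (cong₂ _+_ (∑-+ n (f ∘ (false ∷_)) (g ∘ (false ∷_)))
                                     (∑-+ n (f ∘ (true ∷_)) (g ∘ (true ∷_))))
                          (interchange (∑ n (f ∘ (false ∷_))) (∑ n (g ∘ (false ∷_))) _ _)
    where open CommutativeSemigroupProperties +-commutativeSemigroup using (interchange)

  ∑-swap : ∀ n k (h : F2 n → F2 k → ℤ) → ∑ n (λ u → ∑ k (h u)) ≡ ∑ k (λ x → ∑ n (λ u → h u x))
  ∑-swap zero    k h = refl
  ∑-swap (suc n) k h = trans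
    (cong₂ _+_ (∑-swap n k (h ∘ (false ∷_))) (∑-swap n k (h ∘ (true ∷_))))
    (sym (∑-+ k _ _))

  ∑-translate : ∀ n (y : F2 n) (g : F2 n → ℤ) → ∑ n (λ x → g (x ⊕ y)) ≡ ∑ n g
  ∑-translate zero    []          g = refl
  ∑-translate (suc n) (false ∷ y) g =
    cong₂ _+_ (∑-translate n y (g ∘ (false ∷_))) (∑-translate n y (g ∘ (true ∷_)))
  ∑-translate (suc n) (true ∷ y)  g = trans
    (cong₂ _+_ (∑-translate n y (g ∘ (true ∷_))) (∑-translate n y (g ∘ (false ∷_))))
    (+-comm (∑ n (g ∘ (true ∷_))) (∑ n (g ∘ (false ∷_))))

  ip-⊕ʳ : ∀ {n} (u x y : F2 n) → ip u (x ⊕ y) ≡ ip u x xor ip u y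
  ip-⊕ʳ []      []      []      = refl
  ip-⊕ʳ (a ∷ u) (b ∷ x) (c ∷ y) = begin
    (a ∧ (b xor c)) xor ip u (x ⊕ y)                ≡⟨ cong₂ _xor_ (∧-distribˡ-xor a b c) (ip-⊕ʳ u x y) ⟩
    ((a ∧ b) xor (a ∧ c)) xor (ip u x xor ip u y)   ≡⟨ interchange (a ∧ b) (a ∧ c) (ip u x) (ip u y) ⟩
    ((a ∧ b) xor ip u x) xor ((a ∧ c) xor ip u y)   ∎
    where
    open ≡-Reasoning
    open CommutativeSemigroupProperties (CommutativeRing.+-commutativeSemigroup xor-∧-commutativeRing)
      using (interchange)

  ⊕-cancelʳ : ∀ {n} (x y : F2 n) → (x ⊕ y) ⊕ y ≡ x
  ⊕-cancelʳ []      []      = refl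
  ⊕-cancelʳ (a ∷ x) (b ∷ y) = cong₂ _∷_ xor-cancelʳ (⊕-cancelʳ x y)
    where
    xor-cancelʳ : (a xor b) xor b ≡ a
    xor-cancelʳ = trans (xor-assoc a b b) (trans (cong (a xor_) (xor-same b)) (xor-identityʳ a))

  sgn-not : ∀ b → sgn (not b) ≡ - sgn b
  sgn-not false = refl
  sgn-not true  = refl

  sgn-square : ∀ b → sgn b * sgn b ≡ 1ℤ
  sgn-square false = refl
  sgn-square true  = refl

  δ₀ : ∀ {n} → F2 n → ℤ
  δ₀ []          = 1ℤ
  δ₀ (false ∷ x) = δ₀ x
  δ₀ (true  ∷ x) = 0ℤ

  ∑-character : ∀ {n} (x : F2 n) → ∑ n (λ u → sgn (ip u x)) ≡ + (2 ^ n) * δ₀ x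
  ∑-character []                = refl
  ∑-character {suc n} (false ∷ x) = begin
    ∑ n (λ u → sgn (ip u x)) + ∑ n (λ u → sgn (ip u x))
      ≡⟨ cong₂ _+_ (∑-character x) (∑-character x) ⟩
    + (2 ^ n) * δ₀ x + + (2 ^ n) * δ₀ x
      ≡⟨ *-distribʳ-+ (δ₀ x) (+ (2 ^ n)) (+ (2 ^ n)) ⟨
    (+ (2 ^ n) + + (2 ^ n)) * δ₀ x
      ≡⟨ cong (_* δ₀ x) (pos-+ (2 ^ n) (2 ^ n)) ⟨
    + (2 ^ n ℕ.+ 2 ^ n) * δ₀ x
      ≡⟨ cong (λ k → + (2 ^ n ℕ.+ k) * δ₀ x) (ℕ.+-identityʳ (2 ^ n)) ⟨
    + (2 ^ suc n) * δ₀ x ∎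
    where open ≡-Reasoning
  ∑-character {suc n} (true ∷ x) = begin
    ∑ n (λ u → sgn (ip u x)) + ∑ n (λ u → sgn (not (ip u x)))
      ≡⟨ cong (_+_ (∑ n (λ u → sgn (ip u x)))) (trans (∑-cong n (sgn-not ∘ λ u → ip u x)) (∑-neg n _)) ⟩
    ∑ n (λ u → sgn (ip u x)) + - ∑ n (λ u → sgn (ip u x))
      ≡⟨ +-inverseʳ (∑ n (λ u → sgn (ip u x))) ⟩
    0ℤ
      ≡⟨ *-zeroʳ (+ (2 ^ suc n)) ⟨
    + (2 ^ suc n) * 0ℤ ∎
    where open ≡-Reasoning

  ∑-δ₀ : ∀ n (h : F2 n → ℤ) → ∑ n (λ x → δ₀ x * h x) ≡ h (replicate n false)
  ∑-δ₀ zero    h = *-identityˡ (h [])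
  ∑-δ₀ (suc n) h = begin
    ∑ n (λ x → δ₀ x * h (false ∷ x)) + ∑ n (λ x → 0ℤ * h (true ∷ x))
      ≡⟨ cong₂ _+_ (∑-δ₀ n (h ∘ (false ∷_))) (∑-*ˡ n 0ℤ (h ∘ (true ∷_))) ⟩
    h (replicate (suc n) false) + 0ℤ
      ≡⟨ +-identityʳ _ ⟩
    h (replicate (suc n) false) ∎
    where open ≡-Reasoning

  fourier-inversion-at-0 : ∀ n (h : F2 n → ℤ) →
    ∑ n (λ u → ∑ n (λ x → sgn (ip u x) * h x)) ≡ + (2 ^ n) * h (replicate n false)
  fourier-inversion-at-0 n h = begin
    ∑ n (λ u → ∑ n (λ x → sgn (ip u x) * h x))   ≡⟨ ∑-swap n n _ ⟩
    ∑ n (λ x → ∑ n (λ u → sgn (ip u x) * h x))   ≡⟨ ∑-cong n (λ x → ∑-*ʳ n (h x) (λ u → sgn (ip u x))) ⟩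
    ∑ n (λ x → ∑ n (λ u → sgn (ip u x)) * h x)   ≡⟨ ∑-cong n (λ x → cong (_* h x) (∑-character x)) ⟩
    ∑ n (λ x → + (2 ^ n) * δ₀ x * h x)           ≡⟨ ∑-cong n (λ x → *-assoc (+ (2 ^ n)) (δ₀ x) (h x)) ⟩
    ∑ n (λ x → + (2 ^ n) * (δ₀ x * h x))         ≡⟨ ∑-*ˡ n (+ (2 ^ n)) _ ⟩
    + (2 ^ n) * ∑ n (λ x → δ₀ x * h x)           ≡⟨ cong (+ (2 ^ n) *_) (∑-δ₀ n h) ⟩
    + (2 ^ n) * h (replicate n false)            ∎
    where open ≡-Reasoning

  search : ∀ n (p : F2 n → Bool) → (∃ λ x → p x ≡ true) ⊎ (∀ x → p x ≡ false)
  search zero    p with p [] in p[]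
  ... | true  = inj₁ ([] , p[])
  ... | false = inj₂ λ { [] → p[] }
  search (suc n) p with search n (p ∘ (false ∷_)) | search n (p ∘ (true ∷_))
  ... | inj₁ (x , px) | _             = inj₁ (false ∷ x , px)
  ... | inj₂ _        | inj₁ (x , px) = inj₁ (true ∷ x , px)
  ... | inj₂ none₀    | inj₂ none₁    = inj₂ λ { (false ∷ x) → none₀ x ; (true ∷ x) → none₁ x }

  i≡-i⇒i≡0 : ∀ i → i ≡ - i → i ≡ 0ℤ
  i≡-i⇒i≡0 (+ zero) _ = refl

  hadamard : ∀ {k} → (F2 k → Bool) → F2 k → ℤ
  hadamard {k} V u = ∑ k (λ x → sgn (ip u x) * ind (V x))

  ∑-hadamard : ∀ k (V : F2 k → Bool) → ∑ k (hadamard V) ≡ + (2 ^ k) * ind (V (replicate k false))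
  ∑-hadamard k V = fourier-inversion-at-0 k (ind ∘ V)

  module _ {k r} {V : F2 k → Bool} (V-subspace : IsSubspace k r V) where
    open IsSubspace V-subspace

    translate-mem : ∀ {y} → V y ≡ true → ∀ x → V (x ⊕ y) ≡ V x
    translate-mem {y} Vy x with V x in Vx
    ... | true  = add-mem x y Vx Vy
    ... | false with V (x ⊕ y) in Vx⊕y
    ...   | false = refl
    ...   | true  with () ← trans (sym Vx) (trans (cong V (sym (⊕-cancelʳ x y))) (add-mem _ _ Vx⊕y Vy))

    hadamard-dichotomy : ∀ u → hadamard V u ≡ 0ℤ ⊎ hadamard V u ≡ + (2 ^ r)
    hadamard-dichotomy u with search k (λ x → V x ∧ ip u x)
    ... | inj₂ u⊥V = inj₂ (begin
      ∑ k (λ x → sgn (ip u x) * ind (V x)) ≡⟨ ∑-cong k summand ⟩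
      ∑ k (λ x → + indℕ (V x))             ≡⟨ ∑-pos k (indℕ ∘ V) ⟩
      + sumF2 ℕ._+_ k (indℕ ∘ V)           ≡⟨ cong +_ card ⟩
      + (2 ^ r)                            ∎)
      where
      open ≡-Reasoning
      summand : ∀ x → sgn (ip u x) * ind (V x) ≡ + indℕ (V x)
      summand x with V x | u⊥V x
      ... | false | _        = *-zeroʳ (sgn (ip u x))
      ... | true  | ip≡false rewrite ip≡false = refl
    ... | inj₁ (y , Vy∧uy) = inj₁ (i≡-i⇒i≡0 _ (begin
      ∑ k g                        ≡⟨ ∑-translate k y g ⟨
      ∑ k (λ x → g (x ⊕ y))        ≡⟨ ∑-cong k antisymmetric ⟩
      ∑ k (λ x → - g x)            ≡⟨ ∑-neg k g ⟩
      - ∑ k g                      ∎))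
      where
      open ≡-Reasoning
      g : F2 k → ℤ
      g x = sgn (ip u x) * ind (V x)
      ∧-true⁻ : ∀ {a b} → a ∧ b ≡ true → a ≡ true × b ≡ true
      ∧-true⁻ {true} {true} _ = refl , refl
      antisymmetric : ∀ x → g (x ⊕ y) ≡ - g x
      antisymmetric x with ∧-true⁻ Vy∧uy
      ... | Vy , uy = begin
        sgn (ip u (x ⊕ y)) * ind (V (x ⊕ y))
          ≡⟨ cong₂ (λ b c → sgn b * ind c) (ip-⊕ʳ u x y) (translate-mem Vy x) ⟩
        sgn (ip u x xor ip u y) * ind (V x)
          ≡⟨ cong (λ b → sgn (ip u x xor b) * ind (V x)) uy ⟩
        sgn (ip u x xor true) * ind (V x)
          ≡⟨ cong (λ b → sgn b * ind (V x)) (trans (xor-comm (ip u x) true) (true-xor (ip u x))) ⟩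
        sgn (not (ip u x)) * ind (V x)
          ≡⟨ cong (_* ind (V x)) (sgn-not (ip u x)) ⟩
        - sgn (ip u x) * ind (V x)
          ≡⟨ neg-distribˡ-* (sgn (ip u x)) (ind (V x)) ⟨
        - g x ∎

  prodFin-cong : ∀ d {g h : Fin d → ℤ} → (∀ j → g j ≡ h j) → prodFin d g ≡ prodFin d h
  prodFin-cong zero    g≗h = refl
  prodFin-cong (suc d) g≗h = cong₂ _*_ (g≗h zero) (prodFin-cong d (g≗h ∘ suc))

  prodFin-* : ∀ d (g h : Fin d → ℤ) → prodFin d g * prodFin d h ≡ prodFin d (λ j → g j * h j)
  prodFin-* zero    g h = refl
  prodFin-* (suc d) g h = trans (interchange (g zero) (prodFin d (g ∘ suc)) (h zero) (prodFin d (h ∘ suc)))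
                                (cong (g zero * h zero *_) (prodFin-* d (g ∘ suc) (h ∘ suc)))
    where open CommutativeSemigroupProperties *-commutativeSemigroup using (interchange)

  prodFin-zero : ∀ d (g : Fin d → ℤ) j → g j ≡ 0ℤ → prodFin d g ≡ 0ℤ
  prodFin-zero (suc d) g zero    gj≡0 rewrite gj≡0 = refl
  prodFin-zero (suc d) g (suc j) gj≡0 rewrite prodFin-zero d (g ∘ suc) j gj≡0 = *-zeroʳ (g zero)

  sumIdx-cong : ∀ {d} (n : Fin d → ℕ) {f g : Idx n → ℤ} → (∀ t → f t ≡ g t) → sumIdx n f ≡ sumIdx n g
  sumIdx-cong {zero}  n f≗g = f≗g _
  sumIdx-cong {suc d} n f≗g = ∑-cong (n zero) λ v → sumIdx-cong (n ∘ suc) λ t → f≗g (consIdx v t)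

  sumIdx-*ˡ : ∀ {d} (n : Fin d → ℕ) c (f : Idx n → ℤ) → sumIdx n (λ t → c * f t) ≡ c * sumIdx n f
  sumIdx-*ˡ {zero}  n c f = refl
  sumIdx-*ˡ {suc d} n c f = trans (∑-cong (n zero) λ v → sumIdx-*ˡ (n ∘ suc) c (f ∘ consIdx v))
                                  (∑-*ˡ (n zero) c _)

  sumIdx-prodFin : ∀ {d} (n : Fin d → ℕ) (g : (j : Fin d) → F2 (n j) → ℤ) →
    sumIdx n (λ t → prodFin d (λ j → g j (t j))) ≡ prodFin d (λ j → ∑ (n j) (g j))
  sumIdx-prodFin {zero}  n g = refl
  sumIdx-prodFin {suc d} n g = begin
    ∑ (n zero) (λ v → sumIdx (n ∘ suc) (λ t → g zero v * prodFin d (λ j → g (suc j) (t j))))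
      ≡⟨ ∑-cong (n zero) (λ v → sumIdx-*ˡ (n ∘ suc) (g zero v) _) ⟩
    ∑ (n zero) (λ v → g zero v * sumIdx (n ∘ suc) (λ t → prodFin d (λ j → g (suc j) (t j))))
      ≡⟨ ∑-cong (n zero) (λ v → cong (g zero v *_) (sumIdx-prodFin (n ∘ suc) (g ∘ suc))) ⟩
    ∑ (n zero) (λ v → g zero v * prodFin d (λ j → ∑ (n (suc j)) (g (suc j))))
      ≡⟨ ∑-*ʳ (n zero) _ (g zero) ⟩
    ∑ (n zero) (g zero) * prodFin d (λ j → ∑ (n (suc j)) (g (suc j))) ∎
    where open ≡-Reasoning

  rowSum : ∀ {d} (n : Fin d → ℕ) (V : (j : Fin d) → F2 (n j) → Bool) → Idx n → Signs n → Signs n → ℤ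
  rowSum n V t ξ ξ̂ = sumIdx n (λ b → Fent n t b * tensorSign n ξ b * Evec n V ξ̂ b)

  rowSum-factorises : ∀ {d} (n : Fin d → ℕ) V (t : Idx n) (ξ : Signs n) →
                      rowSum n V t ξ ξ ≡ prodFin d (λ j → hadamard (V j) (t j))
  rowSum-factorises {d} n V t ξ = trans (sumIdx-cong n summand) (sumIdx-prodFin n _)
    where
    open ≡-Reasoning
    summand : ∀ b → Fent n t b * tensorSign n ξ b * Evec n V ξ b
                  ≡ prodFin d (λ j → sgn (ip (t j) (b j)) * ind (V j (b j)))
    summand b = begin
      Fent n t b * tensorSign n ξ b * Evec n V ξ b
        ≡⟨ cong (_* Evec n V ξ b) (prodFin-* d _ _) ⟩
      prodFin d (λ j → sgn (ip (t j) (b j)) * sgn (ξ j (b j))) * Evec n V ξ b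
        ≡⟨ prodFin-* d _ _ ⟩
      prodFin d (λ j → sgn (ip (t j) (b j)) * sgn (ξ j (b j)) * (sgn (ξ j (b j)) * ind (V j (b j))))
        ≡⟨ prodFin-cong d (λ j → signs-cancel (sgn (ip (t j) (b j))) (ξ j (b j)) (ind (V j (b j)))) ⟩
      prodFin d (λ j → sgn (ip (t j) (b j)) * ind (V j (b j))) ∎
      where
      signs-cancel : ∀ a s i → a * sgn s * (sgn s * i) ≡ a * i
      signs-cancel a s i = begin
        a * sgn s * (sgn s * i)   ≡⟨ *-assoc a (sgn s) (sgn s * i) ⟩
        a * (sgn s * (sgn s * i)) ≡⟨ cong (a *_) (*-assoc (sgn s) (sgn s) i) ⟨
        a * (sgn s * sgn s * i)   ≡⟨ cong (λ z → a * (z * i)) (sgn-square s) ⟩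
        a * (1ℤ * i)              ≡⟨ cong (a *_) (*-identityˡ i) ⟩
        a * i                     ∎

module Enumeration where
  open import Data.Bool using (true; false)
  open import Data.Nat using (ℕ; zero; suc; _+_; _*_; _^_; _≤_; s≤s)
  open import Data.Nat.Properties
    using (+-comm; +-assoc; +-identityʳ; *-distribˡ-+; *-distribʳ-+; *-zeroʳ; +-mono-≤; +-monoʳ-≤;
           ≤-refl; ≤-trans; m≤n+m; module ≤-Reasoning)
  open import Data.Nat.ListAction using (sum)
  open import Data.Nat.ListAction.Properties using (sum-++)
  open import Data.Fin using (Fin; zero; suc)
  open import Data.Vec using ([]; _∷_)
  open import Data.Vec.Properties using (∷-injective)
  open import Data.List using (List; []; _∷_; [_]; _++_; map; length; cartesianProductWith; filter)
  open import Data.List.Properties using (map-++; map-∘; map-cong; length-++; length-map)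
  open import Data.List.Membership.Propositional using (_∈_)
  open import Data.List.Membership.Propositional.Properties using (∈-cartesianProductWith⁻)
  import Data.List.Relation.Unary.All as All
  import Data.List.Relation.Unary.AllPairs as AllPairs
  open import Data.List.Relation.Unary.Unique.Propositional using (Unique)
  import Data.List.Relation.Unary.Unique.Propositional.Properties as Unique
  import Data.List.Relation.Unary.Unique.Setoid as Setoidₗ
  import Data.List.Relation.Unary.Unique.Setoid.Properties as Setoidₗ
  open import Data.Product using (_,_)
  open import Function using (_∘_)
  open import Level using (0ℓ)
  open import Relation.Binary.Bundles using (Setoid)
  open import Relation.Binary.PropositionalEquality using (_≡_; refl; sym; trans; cong; cong₂; module ≡-Reasoning)
  open import Relation.Nullary using (¬_; yes; no)
  open import Relation.Unary using (Pred; Decidable)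

  private variable A B C : Set

  module _ (f : A → B → C) where

    length-cartesianProductWith : ∀ xs ys → length (cartesianProductWith f xs ys) ≡ length xs * length ys
    length-cartesianProductWith []       ys = refl
    length-cartesianProductWith (x ∷ xs) ys = begin
      length (map (f x) ys ++ cartesianProductWith f xs ys)        ≡⟨ length-++ (map (f x) ys) ⟩
      length (map (f x) ys) + length (cartesianProductWith f xs ys) ≡⟨ cong₂ _+_ (length-map (f x) ys)
                                                                              (length-cartesianProductWith xs ys) ⟩
      length ys + length xs * length ys                             ∎
      where open ≡-Reasoning

    sum-map-cartesianProductWith : ∀ (g : C → ℕ) xs ys →
      sum (map g (cartesianProductWith f xs ys)) ≡ sum (map (λ x → sum (map (g ∘ f x) ys)) xs)
    sum-map-cartesianProductWith g []       ys = refl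
    sum-map-cartesianProductWith g (x ∷ xs) ys = begin
      sum (map g (map (f x) ys ++ cartesianProductWith f xs ys))
        ≡⟨ cong sum (map-++ g (map (f x) ys) _) ⟩
      sum (map g (map (f x) ys) ++ map g (cartesianProductWith f xs ys))
        ≡⟨ sum-++ (map g (map (f x) ys)) _ ⟩
      sum (map g (map (f x) ys)) + sum (map g (cartesianProductWith f xs ys))
        ≡⟨ cong₂ _+_ (cong sum (map-∘ ys)) (sym (sum-map-cartesianProductWith g xs ys)) ⟨
      sum (map (g ∘ f x) ys) + sum (map (λ x → sum (map (g ∘ f x) ys)) xs) ∎
      where open ≡-Reasoning

  sum-map-*ˡ : ∀ c (g : A → ℕ) xs → sum (map (λ x → c * g x) xs) ≡ c * sum (map g xs)
  sum-map-*ˡ c g []       = sym (*-zeroʳ c)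
  sum-map-*ˡ c g (x ∷ xs) = trans (cong (c * g x +_) (sum-map-*ˡ c g xs)) (sym (*-distribˡ-+ c (g x) _))

  sum-map-*ʳ : ∀ c (g : A → ℕ) xs → sum (map (λ x → g x * c) xs) ≡ sum (map g xs) * c
  sum-map-*ʳ c g []       = refl
  sum-map-*ʳ c g (x ∷ xs) = trans (cong (g x * c +_) (sum-map-*ʳ c g xs)) (sym (*-distribʳ-+ c (g x) _))

  length≤filter+sum : ∀ {P : Pred A 0ℓ} (P? : Decidable P) (w : A → ℕ) → (∀ x → ¬ P x → 1 ≤ w x) →
                      ∀ xs → length xs ≤ length (filter P? xs) + sum (map w xs)
  length≤filter+sum P? w w≥1 []       = ≤-refl
  length≤filter+sum P? w w≥1 (x ∷ xs) with P? x
  ... | yes _  = s≤s (≤-trans (length≤filter+sum P? w w≥1 xs)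
                              (+-monoʳ-≤ (length (filter P? xs)) (m≤n+m (sum (map w xs)) (w x))))
  ... | no ¬Px = begin
    suc (length xs)             ≤⟨ +-mono-≤ (w≥1 x ¬Px) (length≤filter+sum P? w w≥1 xs) ⟩
    w x + (F + S)               ≡⟨ +-comm (w x) (F + S) ⟩
    F + S + w x                 ≡⟨ +-assoc F S (w x) ⟩
    F + (S + w x)               ≡⟨ cong (F +_) (+-comm S (w x)) ⟩
    F + (w x + S)               ∎
    where
    open ≤-Reasoning
    F = length (filter P? xs)
    S = sum (map w xs)

  _∷ᶠ_ : ∀ {k} {A : Fin (suc k) → Set} → A zero → ((i : Fin k) → A (suc i)) → (i : Fin (suc k)) → A i
  (x ∷ᶠ f) zero    = x
  (x ∷ᶠ f) (suc i) = f i

  tuples : ∀ {k} {A : Fin k → Set} → ((i : Fin k) → List (A i)) → List ((i : Fin k) → A i)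
  tuples {zero}  xs = [ (λ ()) ]
  tuples {suc k} xs = cartesianProductWith _∷ᶠ_ (xs zero) (tuples (xs ∘ suc))

  length-tuples : ∀ {k} {A : Fin k → Set} (xs : (i : Fin k) → List (A i)) →
                  length (tuples xs) ≡ prodFinℕ k (length ∘ xs)
  length-tuples {zero}  xs = refl
  length-tuples {suc k} {A} xs = trans (length-cartesianProductWith (_∷ᶠ_ {A = A}) (xs zero) (tuples (xs ∘ suc)))
                                   (cong (length (xs zero) *_) (length-tuples (xs ∘ suc)))

  sum-tuples-prodFinℕ : ∀ {k} {A : Fin k → Set} (xs : (i : Fin k) → List (A i)) (g : (i : Fin k) → A i → ℕ) →
    sum (map (λ t → prodFinℕ k (λ i → g i (t i))) (tuples xs)) ≡ prodFinℕ k (λ i → sum (map (g i) (xs i)))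
  sum-tuples-prodFinℕ {zero}  xs g = refl
  sum-tuples-prodFinℕ {suc k} {A} xs g = begin
    sum (map G (cartesianProductWith _∷ᶠ_ (xs zero) (tuples (xs ∘ suc))))
      ≡⟨ sum-map-cartesianProductWith (_∷ᶠ_ {A = A}) G (xs zero) _ ⟩
    sum (map (λ x → sum (map (λ t → g zero x * G′ t) (tuples (xs ∘ suc)))) (xs zero))
      ≡⟨ cong sum (map-cong (λ x → sum-map-*ˡ (g zero x) G′ (tuples (xs ∘ suc))) (xs zero)) ⟩
    sum (map (λ x → g zero x * sum (map G′ (tuples (xs ∘ suc)))) (xs zero))
      ≡⟨ cong (λ s → sum (map (λ x → g zero x * s) (xs zero))) (sum-tuples-prodFinℕ (xs ∘ suc) (g ∘ suc)) ⟩
    sum (map (λ x → g zero x * prodFinℕ k (λ i → sum (map (g (suc i)) (xs (suc i))))) (xs zero))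
      ≡⟨ sum-map-*ʳ _ (g zero) (xs zero) ⟩
    sum (map (g zero) (xs zero)) * prodFinℕ k (λ i → sum (map (g (suc i)) (xs (suc i)))) ∎
    where
    open ≡-Reasoning
    G = λ t → prodFinℕ (suc k) (λ i → g i (t i))
    G′ = λ t → prodFinℕ k (λ i → g (suc i) (t i))

  ∈-tuples⁻ : ∀ {k} {A : Fin k → Set} (xs : (i : Fin k) → List (A i)) {t} →
              t ∈ tuples xs → ∀ i → t i ∈ xs i
  ∈-tuples⁻ {suc k} xs t∈ i with ∈-cartesianProductWith⁻ _∷ᶠ_ (xs zero) (tuples (xs ∘ suc)) t∈
  ∈-tuples⁻ {suc k} xs t∈ zero    | x , t′ , x∈ , t′∈ , refl = x∈
  ∈-tuples⁻ {suc k} xs t∈ (suc i) | x , t′ , x∈ , t′∈ , refl = ∈-tuples⁻ (xs ∘ suc) t′∈ i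

  -- Without function extensionality, distinctness of tuples is only available up to pointwise equality.
  Πₛ : ∀ {k} → (Fin k → Setoid 0ℓ 0ℓ) → Setoid 0ℓ 0ℓ
  Πₛ {k} S = record
    { Carrier       = (i : Fin k) → Setoid.Carrier (S i)
    ; _≈_           = λ f g → ∀ i → Setoid._≈_ (S i) (f i) (g i)
    ; isEquivalence = record
      { refl  = λ i → Setoid.refl (S i)
      ; sym   = λ f≈g i → Setoid.sym (S i) (f≈g i)
      ; trans = λ f≈g g≈h i → Setoid.trans (S i) (f≈g i) (g≈h i)
      }
    }

  tuples-unique : ∀ {k} (S : Fin k → Setoid 0ℓ 0ℓ) (xs : (i : Fin k) → List (Setoid.Carrier (S i))) →
                  (∀ i → Setoidₗ.Unique (S i) (xs i)) → Setoidₗ.Unique (Πₛ S) (tuples xs)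
  tuples-unique {zero}  S xs xs! = All.[] AllPairs.∷ AllPairs.[]
  tuples-unique {suc k} S xs xs! =
    Setoidₗ.cartesianProductWith⁺ (S zero) (Πₛ (S ∘ suc)) (Πₛ S) _∷ᶠ_
      (λ e → e zero , e ∘ suc) (xs! zero) (tuples-unique (S ∘ suc) (xs ∘ suc) (xs! ∘ suc))

  setoid-unique⇒unique : ∀ (S : Setoid 0ℓ 0ℓ) {xs} → Setoidₗ.Unique S xs → Unique xs
  setoid-unique⇒unique S = AllPairs.map (λ x≉y → x≉y ∘ Setoid.reflexive S)

  allF2 : ∀ n → List (F2 n)
  allF2 zero    = [ [] ]
  allF2 (suc n) = cartesianProductWith _∷_ (false ∷ true ∷ []) (allF2 n)

  allF2-unique : ∀ n → Unique (allF2 n)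
  allF2-unique zero    = All.[] AllPairs.∷ AllPairs.[]
  allF2-unique (suc n) = Unique.cartesianProductWith⁺ _∷_ ∷-injective
    (((λ ()) All.∷ All.[]) AllPairs.∷ (All.[] AllPairs.∷ AllPairs.[])) (allF2-unique n)

  length-allF2 : ∀ n → length (allF2 n) ≡ 2 ^ n
  length-allF2 zero    = refl
  length-allF2 (suc n) = trans (length-cartesianProductWith _∷_ (false ∷ true ∷ []) (allF2 n))
                               (cong (2 *_) (length-allF2 n))

  sum-allF2 : ∀ n (g : F2 n → ℕ) → sum (map g (allF2 n)) ≡ sumF2 _+_ n g
  sum-allF2 zero    g = +-identityʳ (g [])
  sum-allF2 (suc n) g = begin
    sum (map g (cartesianProductWith _∷_ (false ∷ true ∷ []) (allF2 n)))
      ≡⟨ sum-map-cartesianProductWith _∷_ g (false ∷ true ∷ []) (allF2 n) ⟩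
    sum (map (g ∘ (false ∷_)) (allF2 n)) + (sum (map (g ∘ (true ∷_)) (allF2 n)) + 0)
      ≡⟨ cong (sum (map (g ∘ (false ∷_)) (allF2 n)) +_) (+-identityʳ _) ⟩
    sum (map (g ∘ (false ∷_)) (allF2 n)) + sum (map (g ∘ (true ∷_)) (allF2 n))
      ≡⟨ cong₂ _+_ (sum-allF2 n (g ∘ (false ∷_))) (sum-allF2 n (g ∘ (true ∷_))) ⟩
    sumF2 _+_ (suc n) g ∎
    where open ≡-Reasoning

module Counting where
  open HadamardTransform
  open Enumeration
  open import Data.Nat using (ℕ; zero; suc; _+_; _*_; _^_; _≤_; NonZero)
  open import Data.Nat.Properties
    using (*-identityˡ; *-mono-≤; m^n≢0; *-commutativeSemigroup; ≤-refl; module ≤-Reasoning)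
  open import Data.Nat.ListAction using (sum)
  open import Data.Integer as ℤ using (ℤ; +_; -[1+_]; 0ℤ)
  import Data.Integer.Properties as ℤ
  open import Data.Bool using (Bool; false)
  open import Data.Vec using (replicate)
  open import Data.Fin using (Fin; zero; suc)
  open import Data.Fin.Properties using (any?)
  open import Data.List using (List; map; length; filter)
  open import Data.List.Membership.Propositional.Properties using (∈-filter⁻)
  open import Data.List.Relation.Unary.All as All using (All)
  open import Data.List.Relation.Unary.Unique.Propositional using (Unique)
  import Data.List.Relation.Unary.Unique.Setoid as Setoidₗ
  import Data.List.Relation.Unary.Unique.Setoid.Properties as Setoidₗ
  open import Data.Product using (∃; _,_; proj₂)
  open import Data.Sum using (inj₁; inj₂)
  open import Function using (_∘_)
  open import Level using (0ℓ)
  open import Relation.Binary.Bundles using (Setoid)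
  open import Relation.Binary.PropositionalEquality
  open import Relation.Nullary using (¬_)
  open import Relation.Unary using (Decidable)
  import Algebra.Properties.CommutativeSemigroup as CommutativeSemigroupProperties

  prodFinℕ-cong : ∀ d {g h : Fin d → ℕ} → (∀ j → g j ≡ h j) → prodFinℕ d g ≡ prodFinℕ d h
  prodFinℕ-cong zero    g≗h = refl
  prodFinℕ-cong (suc d) g≗h = cong₂ _*_ (g≗h zero) (prodFinℕ-cong d (g≗h ∘ suc))

  prodFinℕ-* : ∀ d (g h : Fin d → ℕ) → prodFinℕ d (λ j → g j * h j) ≡ prodFinℕ d g * prodFinℕ d h
  prodFinℕ-* zero    g h = refl
  prodFinℕ-* (suc d) g h = trans (cong (g zero * h zero *_) (prodFinℕ-* d (g ∘ suc) (h ∘ suc)))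
                                 (interchange (g zero) (h zero) (prodFinℕ d (g ∘ suc)) (prodFinℕ d (h ∘ suc)))
    where open CommutativeSemigroupProperties *-commutativeSemigroup using (interchange)

  prodFinℕ-const : ∀ d c → prodFinℕ d (λ _ → c) ≡ c ^ d
  prodFinℕ-const zero    c = refl
  prodFinℕ-const (suc d) c = cong (c *_) (prodFinℕ-const d c)

  prodFinℕ-pos : ∀ d (g : Fin d → ℕ) → (∀ j → 1 ≤ g j) → 1 ≤ prodFinℕ d g
  prodFinℕ-pos zero    g g≥1 = ≤-refl
  prodFinℕ-pos (suc d) g g≥1 = *-mono-≤ (g≥1 zero) (prodFinℕ-pos d (g ∘ suc) (g≥1 ∘ suc))

  isNonZero : ℤ → ℕ
  isNonZero (+ zero)  = 0
  isNonZero (+ suc _) = 1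
  isNonZero -[1+ _ ]  = 1

  isNonZero-pos : ∀ {z} → ¬ z ≡ 0ℤ → 1 ≤ isNonZero z
  isNonZero-pos {+ zero}  z≢0 with () ← z≢0 refl
  isNonZero-pos {+ suc _} _   = ≤-refl
  isNonZero-pos { -[1+ _ ]} _ = ≤-refl

  isNonZero-+ : ∀ m .{{_ : NonZero m}} → isNonZero (+ m) ≡ 1
  isNonZero-+ (suc _) = refl

  module _ {k r} {V : F2 k → Bool} (V-subspace : IsSubspace k r V) where
    open IsSubspace V-subspace

    hadamard≡isNonZero*2^r : ∀ u → + (isNonZero (hadamard V u) * 2 ^ r) ≡ hadamard V u
    hadamard≡isNonZero*2^r u with hadamard-dichotomy V-subspace u
    ... | inj₁ ≡0   rewrite ≡0   = refl
    ... | inj₂ ≡2^r rewrite ≡2^r | isNonZero-+ (2 ^ r) {{m^n≢0 2 r}} = cong +_ (*-identityˡ (2 ^ r))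

    count-hadamard≢0 : sum (map (isNonZero ∘ hadamard V) (allF2 k)) * 2 ^ r ≡ 2 ^ k
    count-hadamard≢0 = ℤ.+-injective (begin
      + (sum (map w (allF2 k)) * 2 ^ r)        ≡⟨ cong +_ (sum-map-*ʳ (2 ^ r) w (allF2 k)) ⟨
      + sum (map (λ u → w u * 2 ^ r) (allF2 k)) ≡⟨ cong +_ (sum-allF2 k _) ⟩
      + sumF2 _+_ k (λ u → w u * 2 ^ r)        ≡⟨ ∑-pos k _ ⟨
      ∑ k (λ u → + (w u * 2 ^ r))              ≡⟨ ∑-cong k hadamard≡isNonZero*2^r ⟩
      ∑ k (hadamard V)                         ≡⟨ ∑-hadamard k V ⟩
      + (2 ^ k) ℤ.* ind (V (replicate k false)) ≡⟨ cong (λ b → + (2 ^ k) ℤ.* ind b) zero-mem ⟩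
      + (2 ^ k) ℤ.* + 1                         ≡⟨ ℤ.*-identityʳ _ ⟩
      + (2 ^ k)                                ∎)
      where
      open ≡-Reasoning
      w = isNonZero ∘ hadamard V

  module Annihilation {d} (n : Fin d → ℕ) {r} {V : (j : Fin d) → F2 (n j) → Bool}
           (V-subspace : (j : Fin d) → IsSubspace (n j) r (V j)) where

    Annihilated : Idx n → Set
    Annihilated t = ∃ λ j → hadamard (V j) (t j) ≡ 0ℤ

    annihilated? : Decidable Annihilated
    annihilated? t = any? λ j → hadamard (V j) (t j) ℤ.≟ 0ℤ

    rowSum-annihilated : ∀ {t} → Annihilated t → (ξ : Signs n) → rowSum n V t ξ ξ ≡ 0ℤ
    rowSum-annihilated {t} (j , hadamard≡0) ξ =
      trans (rowSum-factorises n V t ξ) (prodFin-zero d _ j hadamard≡0)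

    allIdx : List (Idx n)
    allIdx = tuples (allF2 ∘ n)

    annihilatedIdx : List (Idx n)
    annihilatedIdx = filter annihilated? allIdx

    IdxSetoid : Setoid 0ℓ 0ℓ
    IdxSetoid = Πₛ (setoid ∘ F2 ∘ n)

    annihilatedIdx-unique : Setoidₗ.Unique IdxSetoid annihilatedIdx
    annihilatedIdx-unique = Setoidₗ.filter⁺ IdxSetoid annihilated?
                              (tuples-unique (setoid ∘ F2 ∘ n) (allF2 ∘ n) (allF2-unique ∘ n))

    nonAnnihilatedCount : ℕ
    nonAnnihilatedCount = prodFinℕ d (λ j → sum (map (isNonZero ∘ hadamard (V j)) (allF2 (n j))))

    size≡nonAnnihilatedCount*2^rd : prodFinℕ d (λ j → 2 ^ n j) ≡ nonAnnihilatedCount * (2 ^ r) ^ d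
    size≡nonAnnihilatedCount*2^rd = begin
      prodFinℕ d (λ j → 2 ^ n j)
        ≡⟨ prodFinℕ-cong d (λ j → count-hadamard≢0 (V-subspace j)) ⟨
      prodFinℕ d (λ j → sum (map (isNonZero ∘ hadamard (V j)) (allF2 (n j))) * 2 ^ r)
        ≡⟨ prodFinℕ-* d _ _ ⟩
      nonAnnihilatedCount * prodFinℕ d (λ _ → 2 ^ r)
        ≡⟨ cong (nonAnnihilatedCount *_) (prodFinℕ-const d (2 ^ r)) ⟩
      nonAnnihilatedCount * (2 ^ r) ^ d ∎
      where open ≡-Reasoning

    size≤annihilated+nonAnnihilated : prodFinℕ d (λ j → 2 ^ n j) ≤ length annihilatedIdx + nonAnnihilatedCount
    size≤annihilated+nonAnnihilated = begin
      prodFinℕ d (λ j → 2 ^ n j)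
        ≡⟨ prodFinℕ-cong d (length-allF2 ∘ n) ⟨
      prodFinℕ d (length ∘ allF2 ∘ n)
        ≡⟨ length-tuples (allF2 ∘ n) ⟨
      length allIdx
        ≤⟨ length≤filter+sum annihilated? weight weight-pos allIdx ⟩
      length annihilatedIdx + sum (map weight allIdx)
        ≡⟨ cong (_+_ (length annihilatedIdx)) (sum-tuples-prodFinℕ (allF2 ∘ n) _) ⟩
      length annihilatedIdx + nonAnnihilatedCount ∎
      where
      open ≤-Reasoning
      weight : Idx n → ℕ
      weight t = prodFinℕ d (λ j → isNonZero (hadamard (V j) (t j)))
      weight-pos : ∀ t → ¬ Annihilated t → 1 ≤ weight t
      weight-pos t ¬annihilated =
        prodFinℕ-pos d _ λ j → isNonZero-pos λ hadamard≡0 → ¬annihilated (j , hadamard≡0)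

    samples : ∀ m → List (Sample n m)
    samples m = tuples (λ _ → annihilatedIdx)

    samples-unique : ∀ m → Unique (samples m)
    samples-unique m = setoid-unique⇒unique (Πₛ λ _ → IdxSetoid)
                         (tuples-unique (λ _ → IdxSetoid) _ (λ _ → annihilatedIdx-unique))

    samples-killAll : ∀ m → All (KillsAll n m V) (samples m)
    samples-killAll m = All.tabulate λ {ω} ω∈ ξ → ξ , λ i →
      rowSum-annihilated {ω i} (proj₂ (∈-filter⁻ annihilated? {xs = allIdx}
                                        (∈-tuples⁻ (λ _ → annihilatedIdx) ω∈ i))) ξ

    length-samples : ∀ m → length (samples m) ≡ length annihilatedIdx ^ m
    length-samples m = trans (length-tuples {m} (λ _ → annihilatedIdx)) (prodFinℕ-const m _)

open import Data.Nat using (ℕ; suc; _^_; _*_; _≤_)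
open import Data.Fin using (Fin)
open import Data.Bool using (Bool)

mainTheorem10 : (d : ℕ) → 1 ≤ d → (n : Fin d → ℕ) → ((j : Fin d) → 1 ≤ n j) →
    (m : ℕ) → 1 ≤ m → (r : ℕ) → 2 ≤ r → ((j : Fin d) → r ≤ n j) →
    (V : (j : Fin d) → F2 (n j) → Bool) → ((j : Fin d) → IsSubspace (n j) r (V j)) →
    (a b : ℕ) → 1 ≤ b → LeExpNeg a b (2 * m) ((2 ^ r) ^ d) →
    ProbAtLeast n m (KillsAll n m V) a b
mainTheorem10 d 1≤d n _ m 1≤m r 2≤r _ V V-subspace a b _ hyp =
  samples m , samples-unique m , samples-killAll m , (begin
    a * prodFinℕ d (λ j → 2 ^ n j) ^ m  ≡⟨ cong (λ N → a * N ^ m) size≡nonAnnihilatedCount*2^rd ⟩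
    a * (nonAnnihilatedCount * S) ^ m   ≤⟨ good-fraction-bound a b m (<⇒≤ 2≤S) few-nonAnnihilated
                                                                 (leExpNeg⇒ S m 2≤S 1≤m hyp) ⟩
    b * length annihilatedIdx ^ m       ≡⟨ cong (b *_) (length-samples m) ⟨
    b * length (samples m)              ∎)
  where
  open Counting.Annihilation n V-subspace
  open TruncatedExponential using (leExpNeg⇒; good-fraction-bound)
  open import Data.Nat using (_+_)
  open import Data.Nat.Properties using (<⇒≤; ^-*-assoc; ^-monoʳ-≤; *-mono-≤; module ≤-Reasoning)
  open import Data.List using (length)
  open import Data.Product using (_,_)
  open import Relation.Binary.PropositionalEquality using (cong; subst; sym)
  open ≤-Reasoning
  S = (2 ^ r) ^ d
  2≤S : 2 ≤ S
  2≤S = subst (2 ≤_) (sym (^-*-assoc 2 r d)) (^-monoʳ-≤ 2 (*-mono-≤ (<⇒≤ 2≤r) 1≤d))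
  few-nonAnnihilated : nonAnnihilatedCount * S ≤ length annihilatedIdx + nonAnnihilatedCount
  few-nonAnnihilated = subst (_≤ length annihilatedIdx + nonAnnihilatedCount) size≡nonAnnihilatedCount*2^rd
                             size≤annihilated+nonAnnihilated
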